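{- Let $n\ge 2$, $d\ge 0$, and let $C$ be an $n\times n$ circulant matrix with generator $(c_0,\ldots,c_{n-1})$ such that $c_0=d$, $c_j\in\{1,-1\}$ for $j=1,\ldots,n-1$, and $CC^T=(d^2+n-1)I$. Then $2d$ is an integer and $n\geq 2(d+1)$. Moreover: \begin{itemize} \item if $d$ is an integer, then $n$ is even, and $d$ is odd if and only if $\frac{n}{2}$ is even; \item if $d$ is a half-integer (i.e. $d-\frac12\in\mathbb{Z}$), then $n$ is odd and $n=2(d+1)$. \end{itemize}
   Context: A circulant matrix of order $n$ with generator $(c_0,c_1,\ldots,c_{n-1})$ is the $n\times n$ matrix whose entry in row $i$ and column $j$ (indices $0,\ldots,n-1$) is $c_{(j-i)\bmod n}$.
   Formalization: The parameter d and the entries of the circulant matrix C are rational rather than real. -}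

module Defs where

open import Data.Nat as ℕ using (ℕ; zero; suc; _∸_)
open import Data.Nat.DivMod using (_%_; m%n<n)
open import Data.Fin as Fin using (Fin; toℕ; fromℕ<)
open import Data.Rational using (ℚ; 0ℚ; _+_; _*_)
open import Relation.Nullary using (does)
open import Data.Bool using (if_then_else_)

Σ : (n : ℕ) → (Fin n → ℚ) → ℚ
Σ zero    f = 0ℚ
Σ (suc n) f = f Fin.zero + Σ n (λ k → f (Fin.suc k))

Matrix : ℕ → Set
Matrix n = Fin n → Fin n → ℚ

-- (j - i) mod n, as an element of Fin n.
diffMod : {n : ℕ} → Fin n → Fin n → Fin n
diffMod {suc m} i j = fromℕ< (m%n<n (suc m ℕ.+ toℕ j ∸ toℕ i) (suc m))

circulant : {n : ℕ} → (Fin n → ℚ) → Matrix n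
circulant c i j = c (diffMod i j)

transpose : {n : ℕ} → Matrix n → Matrix n
transpose A i j = A j i

infixl 7 _·_
_·_ : {n : ℕ} → Matrix n → Matrix n → Matrix n
_·_ {n} A B i j = Σ n (λ k → A i k * B k j)

scalarI : {n : ℕ} → ℚ → Matrix n
scalarI λ' i j = if does (i Fin.≟ j) then λ' else 0ℚ

module Submission where

-- Replace the entry c₀ = d by 1 to get a ±1 sequence σ, and let R(s) = Σₖ σₖ σₖ₊ₛ (indices mod n).
-- The off-diagonal entries of C Cᵀ are the periodic autocorrelations of c, which differ from R(s)
-- only in the two terms meeting index 0:  R(s) + (d - 1)(σₛ + σ₋ₛ) = 0.  Since σ is ±1-valued,
-- R(s) ≡ n (mod 4).  If σₛ ≠ σ₋ₛ this forces R(s) = 0, so n is even; hence s = 1 or s = n/2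
-- satisfies σₛ = σ₋ₛ = ε, and then 2d = 2 - ε R(s) is an integer with 2d ≡ 2 - ε n (mod 4), which
-- gives the parity statements.  The terms k = 0 and k = -s of ε R(s) equal 1, so ε R(s) ≥ 4 - n,
-- i.e. 2(d + 1) ≤ n.  For odd n every shift is symmetric, all with the same ε (2d ≡ 2 - ε n (mod 4)
-- cannot hold for both signs); replacing c₀ by ε instead of 1 then gives a constant sign sequence,
-- and R(1) = n turns the equation into n + 2ε(d - ε) = 0, which forces ε = -1 (as d ≥ 0) and
-- n = 2(d + 1).

open import Algebra.Bundles using (CommutativeRing)
import Algebra.Properties.CommutativeMonoid.Sum as CommutativeMonoidSum
open import Data.Bool.Base using (true; false; if_then_else_)
open import Data.Empty using (⊥-elim)
open import Data.Fin.Base using (Fin; zero; suc; toℕ; fromℕ; fromℕ<; inject₁)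
import Data.Fin.Properties as Fin
open import Data.Integer.Base as ℤ using (ℤ; +_; -[1+_]; +[1+_]; 0ℤ; 1ℤ; -1ℤ)
import Data.Integer.Properties as ℤ
import Data.Integer.Divisibility.Signed as ℤ
open import Data.Integer.Divisibility.Signed using (divides)
import Data.Integer.Solver
open import Data.Nat.Base as ℕ using (ℕ; suc; _<_; _≤_; _∸_; s≤s; z≤n)
import Data.Nat.Properties as ℕ
import Data.Nat.Divisibility as ℕ
open import Data.Nat.Coprimality using (1-coprimeTo) renaming (sym to coprime-sym)
open import Data.Nat.DivMod using (_/_; _mod_; m/n*n≡m; [m+n]%n≡m%n; m<n⇒m%n≡m)
open import Data.Product.Base using (_×_; _,_)
open import Data.Rational.Base as ℚ using (ℚ; mkℚ; 0ℚ; 1ℚ)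
import Data.Rational.Properties as ℚ
open import Algebra.Properties.Ring ℚ.+-*-ring using (-‿involutive)
import Data.Rational.Solver
open import Data.Sum.Base using (_⊎_; inj₁; inj₂)
open import Function.Bundles using (_⇔_; mk⇔)
open import Relation.Nullary using (¬_; yes; no; does)
open import Relation.Nullary.Decidable using (decidable-stable)
open import Relation.Binary.PropositionalEquality as ≡
  using (_≡_; _≢_; refl; sym; trans; cong; cong₂; subst; subst₂; module ≡-Reasoning)

open import Defs

-- Cyclic sums and periodic autocorrelation

module CyclicSums {c ℓ} (R : CommutativeRing c ℓ) (m : ℕ) where

  open CommutativeRing R renaming (refl to ≈-refl; sym to ≈-sym; trans to ≈-trans)
  open import Algebra.Properties.CommutativeMonoid.Sum +-commutativeMonoid
  open import Algebra.Properties.Semiring.Sum semiring using (*-distribˡ-sum)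
  open import Algebra.Solver.Ring.NaturalCoefficients.Default commutativeSemiring
  open import Relation.Binary.Reasoning.Setoid setoid

  n : ℕ
  n = suc m

  Periodic : (ℕ → Carrier) → Set ℓ
  Periodic x = ∀ k → x (n ℕ.+ k) ≈ x k

  periodic-shift : ∀ {x} → Periodic x → ∀ r → Periodic (λ k → x (k ℕ.+ r))
  periodic-shift {x} per r k = ≈-trans (reflexive (≡.cong x (ℕ.+-assoc n k r))) (per (k ℕ.+ r))

  periodic-* : ∀ {x y} → Periodic x → Periodic y → Periodic (λ k → x k * y k)
  periodic-* perx pery k = *-cong (perx k) (pery k)

  ∑-shift₁ : ∀ (x : ℕ → Carrier) → Periodic x → ∑[ k < n ] x (suc (toℕ k)) ≈ ∑[ k < n ] x (toℕ k)
  ∑-shift₁ x per = begin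
    ∑[ k < n ] x (suc (toℕ k))
      ≈⟨ sum-init-last (λ k → x (suc (toℕ k))) ⟩
    ∑[ k < m ] x (suc (toℕ (inject₁ k))) + x (suc (toℕ (fromℕ m)))
      ≡⟨ ≡.cong₂ _+_ (sum-cong-≗ {m} (λ k → ≡.cong (λ i → x (suc i)) (Fin.toℕ-inject₁ k)))
                     (≡.cong (λ i → x (suc i)) (Fin.toℕ-fromℕ m)) ⟩
    ∑[ k < m ] x (suc (toℕ k)) + x n
      ≈⟨ +-congˡ (≈-trans (reflexive (≡.cong x (≡.sym (ℕ.+-identityʳ n)))) (per 0)) ⟩
    ∑[ k < m ] x (suc (toℕ k)) + x 0
      ≈⟨ +-comm _ _ ⟩
    ∑[ k < n ] x (toℕ k) ∎

  ∑-shift : ∀ (x : ℕ → Carrier) → Periodic x → ∀ r → ∑[ k < n ] x (toℕ k ℕ.+ r) ≈ ∑[ k < n ] x (toℕ k)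
  ∑-shift x per ℕ.zero = reflexive (sum-cong-≗ {n} (λ k → ≡.cong x (ℕ.+-identityʳ (toℕ k))))
  ∑-shift x per (suc r) = begin
    ∑[ k < n ] x (toℕ k ℕ.+ suc r)    ≡⟨ sum-cong-≗ {n} (λ k → ≡.cong x (ℕ.+-suc (toℕ k) r)) ⟩
    ∑[ k < n ] x (suc (toℕ k) ℕ.+ r)  ≈⟨ ∑-shift₁ (λ k → x (k ℕ.+ r)) (periodic-shift per r) ⟩
    ∑[ k < n ] x (toℕ k ℕ.+ r)        ≈⟨ ∑-shift x per r ⟩
    ∑[ k < n ] x (toℕ k)              ∎

  cyclic : (Fin n → Carrier) → ℕ → Carrier
  cyclic f k = f (k mod n)

  cyclic-periodic : ∀ f → Periodic (cyclic f)
  cyclic-periodic f k = reflexive (≡.cong f (Fin.fromℕ<-cong _ _ n+k%n≡k%n _ _))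
    where
    n+k%n≡k%n = ≡.trans (≡.cong (ℕ._% n) (ℕ.+-comm n k)) ([m+n]%n≡m%n k n)

  cyclic-toℕ : ∀ f (j : Fin n) → cyclic f (toℕ j) ≡ f j
  cyclic-toℕ f j = ≡.cong f (≡.trans (Fin.fromℕ<-cong _ _ (m<n⇒m%n≡m (Fin.toℕ<n j)) _ (Fin.toℕ<n j))
                                     (Fin.fromℕ<-toℕ j (Fin.toℕ<n j)))

  autocorrelation : (ℕ → Carrier) → ℕ → Carrier
  autocorrelation x s = ∑[ k < n ] (x (toℕ k) * x (toℕ k ℕ.+ s))

  Perfect : (ℕ → Carrier) → Set ℓ
  Perfect x = ∀ {s} → 0 < s → s < n → autocorrelation x s ≈ 0#

  impulse : Fin n → Carrier
  impulse zero    = 1#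
  impulse (suc _) = 0#

  impulse-off-zero : ∀ {s} → 0 < s → s < n → cyclic impulse s ≈ 0#
  impulse-off-zero {suc s} _ s<n =
    reflexive (≡.cong impulse (Fin.fromℕ<-cong _ _ (m<n⇒m%n≡m s<n) _ s<n))

  ∑-impulse : ∀ (x : ℕ → Carrier) → ∑[ k < n ] (cyclic impulse (toℕ k) * x (toℕ k)) ≈ x 0
  ∑-impulse x = begin
    ∑[ k < n ] (cyclic impulse (toℕ k) * x (toℕ k))
      ≡⟨ sum-cong-≗ {n} (λ k → ≡.cong (λ v → v * x (toℕ k)) (cyclic-toℕ impulse k)) ⟩
    1# * x 0 + ∑[ k < m ] (0# * x (suc (toℕ k)))
      ≈⟨ +-cong (*-identityˡ _) (≈-trans (sum-cong-≋ {m} (λ _ → zeroˡ _)) (sum-replicate-zero m)) ⟩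
    x 0 + 0#
      ≈⟨ +-identityʳ _ ⟩
    x 0 ∎

  ∑-impulse-shifted : ∀ {x} → Periodic x → ∀ {s} → s ≤ n →
    ∑[ k < n ] (x (toℕ k) * cyclic impulse (toℕ k ℕ.+ s)) ≈ x (n ∸ s)
  ∑-impulse-shifted {x} per {s} s≤n = begin
    ∑[ k < n ] (x (toℕ k) * δ (toℕ k ℕ.+ s))
      ≈⟨ ∑-shift (λ k → x k * δ (k ℕ.+ s))
                 (periodic-* per (periodic-shift (cyclic-periodic impulse) s)) (n ∸ s) ⟨
    ∑[ k < n ] (x (toℕ k ℕ.+ (n ∸ s)) * δ (toℕ k ℕ.+ (n ∸ s) ℕ.+ s))
      ≈⟨ sum-cong-≋ {n} (λ k → ≈-trans (*-congˡ {x (toℕ k ℕ.+ (n ∸ s))} (δ-wraps (toℕ k)))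
                                        (*-comm _ _)) ⟩
    ∑[ k < n ] (δ (toℕ k) * x (toℕ k ℕ.+ (n ∸ s)))
      ≈⟨ ∑-impulse (λ k → x (k ℕ.+ (n ∸ s))) ⟩
    x (n ∸ s) ∎
    where
    δ = cyclic impulse
    δ-wraps : ∀ k → δ (k ℕ.+ (n ∸ s) ℕ.+ s) ≈ δ k
    δ-wraps k = ≈-trans (reflexive (≡.cong δ k+[n∸s]+s≡n+k)) (cyclic-periodic impulse k)
      where
      k+[n∸s]+s≡n+k = ≡.trans (ℕ.+-assoc k (n ∸ s) s)
                              (≡.trans (≡.cong (k ℕ.+_) (ℕ.m∸n+n≡m s≤n)) (ℕ.+-comm k n))

  autocorrelation-perturb : ∀ (f g : Fin n → Carrier) a → (∀ j → f j ≈ g j + a * impulse j) →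
    ∀ {s} → 0 < s → s < n →
    autocorrelation (cyclic f) s ≈ autocorrelation (cyclic g) s + a * (cyclic g s + cyclic g (n ∸ s))
  autocorrelation-perturb f g a f≈g+aδ {s} 0<s s<n = begin
    autocorrelation (cyclic f) s
      ≈⟨ sum-cong-≋ {n} (λ k →
           ≈-trans (*-cong (f≈g+aδ (toℕ k mod n)) (f≈g+aδ ((toℕ k ℕ.+ s) mod n)))
                   (expand (y (toℕ k)) (y (toℕ k ℕ.+ s)) (δ (toℕ k)) (δ (toℕ k ℕ.+ s)) a)) ⟩
    ∑[ k < n ] (Y k + (a * D₁ k + (a * D₂ k + a * a * D₃ k)))
      ≈⟨ ≈-trans (∑-distrib-+ Y (λ k → a * D₁ k + (a * D₂ k + a * a * D₃ k)))
                 (+-congˡ (≈-trans (∑-distrib-+ (λ k → a * D₁ k) (λ k → a * D₂ k + a * a * D₃ k))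
                                   (+-congˡ (∑-distrib-+ (λ k → a * D₂ k) (λ k → a * a * D₃ k))))) ⟩
    autocorrelation y s + (∑[ k < n ] (a * D₁ k) + (∑[ k < n ] (a * D₂ k) + ∑[ k < n ] (a * a * D₃ k)))
      ≈⟨ +-congˡ (+-cong (≈-sym (*-distribˡ-sum a D₁))
                 (+-cong (≈-sym (*-distribˡ-sum a D₂)) (≈-sym (*-distribˡ-sum (a * a) D₃)))) ⟩
    autocorrelation y s + (a * ∑[ k < n ] D₁ k + (a * ∑[ k < n ] D₂ k + a * a * ∑[ k < n ] D₃ k))
      ≈⟨ +-congˡ (+-cong (*-congˡ (∑-impulse (λ k → y (k ℕ.+ s))))
                 (+-cong (*-congˡ (∑-impulse-shifted (cyclic-periodic g) (ℕ.<⇒≤ s<n)))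
                         (*-congˡ (≈-trans (∑-impulse (λ k → δ (k ℕ.+ s))) (impulse-off-zero 0<s s<n))))) ⟩
    autocorrelation y s + (a * y s + (a * y (n ∸ s) + a * a * 0#))
      ≈⟨ collect (autocorrelation y s) (y s) (y (n ∸ s)) a ⟩
    autocorrelation y s + a * (y s + y (n ∸ s)) ∎
    where
    y = cyclic g
    δ = cyclic impulse
    Y D₁ D₂ D₃ : Fin n → Carrier
    Y k  = y (toℕ k) * y (toℕ k ℕ.+ s)
    D₁ k = δ (toℕ k) * y (toℕ k ℕ.+ s)
    D₂ k = y (toℕ k) * δ (toℕ k ℕ.+ s)
    D₃ k = δ (toℕ k) * δ (toℕ k ℕ.+ s)
    expand : ∀ u v p q b →
      (u + b * p) * (v + b * q) ≈ u * v + (b * (p * v) + (b * (u * q) + b * b * (p * q)))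
    expand = solve 5 (λ u v p q b → (u :+ b :* p) :* (v :+ b :* q)
                        := u :* v :+ (b :* (p :* v) :+ (b :* (u :* q) :+ b :* b :* (p :* q)))) ≈-refl
    collect : ∀ r u w b → r + (b * u + (b * w + b * b * 0#)) ≈ r + b * (u + w)
    collect = solve 4 (λ r u w b → r :+ (b :* u :+ (b :* w :+ b :* b :* con 0))
                                 := r :+ b :* (u :+ w)) ≈-refl

module ℤCyclic = CyclicSums ℤ.+-*-commutativeRing
module ℚCyclic = CyclicSums ℚ.+-*-commutativeRing
module ℤ∑ = CommutativeMonoidSum ℤ.+-0-commutativeMonoid
module ℚ∑ = CommutativeMonoidSum ℚ.+-0-commutativeMonoid

ι : ℤ → ℚ
ι z = z ℚ./ 1

ι≡mkℚ : ∀ z → ι z ≡ mkℚ z 0 (coprime-sym (1-coprimeTo ℤ.∣ z ∣))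
ι≡mkℚ (+ n)    = ℚ.normalize-coprime {n} {0} _
ι≡mkℚ -[1+ n ] = cong ℚ.-_ (ℚ.normalize-coprime {suc n} {0} _)

ι-+ : ∀ a b → ι (a ℤ.+ b) ≡ ι a ℚ.+ ι b
ι-+ a b rewrite ι≡mkℚ a | ι≡mkℚ b = cong (ℚ._/ 1) (sym (cong₂ ℤ._+_ (ℤ.*-identityʳ a) (ℤ.*-identityʳ b)))

ι-* : ∀ a b → ι (a ℤ.* b) ≡ ι a ℚ.* ι b
ι-* a b rewrite ι≡mkℚ a | ι≡mkℚ b = refl

ι-neg : ∀ a → ι (ℤ.- a) ≡ ℚ.- ι a
ι-neg (+ 0)    = refl
ι-neg +[1+ n ] = refl
ι-neg -[1+ n ] = sym (-‿involutive (ι +[1+ n ]))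

ι-injective : ∀ {a b} → ι a ≡ ι b → a ≡ b
ι-injective {a} {b} eq rewrite ι≡mkℚ a | ι≡mkℚ b = cong ℚ.numerator eq

ι-mono-≤ : ∀ {a b} → a ℤ.≤ b → ι a ℚ.≤ ι b
ι-mono-≤ {a} {b} a≤b rewrite ι≡mkℚ a | ι≡mkℚ b =
  ℚ.*≤* (subst₂ ℤ._≤_ (sym (ℤ.*-identityʳ a)) (sym (ℤ.*-identityʳ b)) a≤b)

ι-cancel-≤ : ∀ {a b} → ι a ℚ.≤ ι b → a ℤ.≤ b
ι-cancel-≤ {a} {b} ιa≤ιb rewrite ι≡mkℚ a | ι≡mkℚ b =
  subst₂ ℤ._≤_ (ℤ.*-identityʳ a) (ℤ.*-identityʳ b) (ℚ.drop-*≤* ιa≤ιb)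

ι-∑ : ∀ {n} (f : Fin n → ℤ) → ι (ℤ∑.sum f) ≡ ℚ∑.sum (λ k → ι (f k))
ι-∑ {ℕ.zero} f = refl
ι-∑ {suc n}  f = trans (ι-+ (f zero) _) (cong (ι (f zero) ℚ.+_) (ι-∑ (λ k → f (suc k))))

ι-autocorrelation : ∀ m (x : ℕ → ℤ) s →
  ι (ℤCyclic.autocorrelation m x s) ≡ ℚCyclic.autocorrelation m (λ k → ι (x k)) s
ι-autocorrelation m x s = trans (ι-∑ {suc m} (λ k → x (toℕ k) ℤ.* x (toℕ k ℕ.+ s)))
  (ℚ∑.sum-cong-≗ {suc m} (λ k → ι-* (x (toℕ k)) (x (toℕ k ℕ.+ s))))

-- Sequences of signs

IsSign : ℤ → Set
IsSign x = x ≡ 1ℤ ⊎ x ≡ -1ℤ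

isSign-* : ∀ {x y} → IsSign x → IsSign y → IsSign (x ℤ.* y)
isSign-* (inj₁ refl) (inj₁ refl) = inj₁ refl
isSign-* (inj₁ refl) (inj₂ refl) = inj₂ refl
isSign-* (inj₂ refl) (inj₁ refl) = inj₂ refl
isSign-* (inj₂ refl) (inj₂ refl) = inj₁ refl

isSign-square : ∀ {x} → IsSign x → x ℤ.* x ≡ 1ℤ
isSign-square (inj₁ refl) = refl
isSign-square (inj₂ refl) = refl

isSign⇒0≤1+x : ∀ {x} → IsSign x → 0ℤ ℤ.≤ 1ℤ ℤ.+ x
isSign⇒0≤1+x (inj₁ refl) = ℤ.+≤+ z≤n
isSign⇒0≤1+x (inj₂ refl) = ℤ.+≤+ z≤n

isSign⇒2∣x-1 : ∀ {x} → IsSign x → + 2 ℤ.∣ x ℤ.- 1ℤ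
isSign⇒2∣x-1 (inj₁ refl) = divides 0ℤ refl
isSign⇒2∣x-1 (inj₂ refl) = divides -1ℤ refl

isSign-opposite : ∀ {x y} → IsSign x → IsSign y → x ≢ y → x ℤ.+ y ≡ 0ℤ
isSign-opposite (inj₁ refl) (inj₁ refl) x≢y = ⊥-elim (x≢y refl)
isSign-opposite (inj₁ refl) (inj₂ refl) _   = refl
isSign-opposite (inj₂ refl) (inj₁ refl) _   = refl
isSign-opposite (inj₂ refl) (inj₂ refl) x≢y = ⊥-elim (x≢y refl)

sign : ℚ → ℤ
sign q = if does (q ℚ.≟ 1ℚ) then 1ℤ else -1ℤ

sign-isSign : ∀ q → IsSign (sign q)
sign-isSign q with does (q ℚ.≟ 1ℚ)
... | true  = inj₁ refl
... | false = inj₂ refl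

ι-sign : ∀ {q} → q ≡ 1ℚ ⊎ q ≡ ℚ.- 1ℚ → ι (sign q) ≡ q
ι-sign (inj₁ refl) = refl
ι-sign (inj₂ refl) = refl

∑-ones : ∀ n → ℤ∑.sum {n} (λ _ → 1ℤ) ≡ + n
∑-ones ℕ.zero  = refl
∑-ones (suc n) = cong (λ x → 1ℤ ℤ.+ x) (∑-ones n)

∣-∑ : ∀ {d n} (f : Fin n → ℤ) → (∀ k → d ℤ.∣ f k) → d ℤ.∣ ℤ∑.sum f
∣-∑ {n = ℕ.zero} f d∣f = divides 0ℤ refl
∣-∑ {n = suc n}  f d∣f = ℤ.∣m∣n⇒∣m+n (d∣f zero) (∣-∑ (λ k → f (suc k)) (λ k → d∣f (suc k)))

∑-nonneg : ∀ {n} (f : Fin n → ℤ) → (∀ k → 0ℤ ℤ.≤ f k) → 0ℤ ℤ.≤ ℤ∑.sum f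
∑-nonneg {ℕ.zero} f 0≤f = ℤ.≤-refl
∑-nonneg {suc n}  f 0≤f = ℤ.+-mono-≤ (0≤f zero) (∑-nonneg (λ k → f (suc k)) (λ k → 0≤f (suc k)))

term≤∑ : ∀ {n} (f : Fin n → ℤ) → (∀ k → 0ℤ ℤ.≤ f k) → ∀ i → f i ℤ.≤ ℤ∑.sum f
term≤∑ f 0≤f zero = subst (ℤ._≤ ℤ∑.sum f) (ℤ.+-identityʳ (f zero))
  (ℤ.+-monoʳ-≤ (f zero) (∑-nonneg (λ k → f (suc k)) (λ k → 0≤f (suc k))))
term≤∑ f 0≤f (suc i) = subst (ℤ._≤ ℤ∑.sum f) (ℤ.+-identityˡ (f (suc i)))
  (ℤ.+-mono-≤ (0≤f zero) (term≤∑ (λ k → f (suc k)) (λ k → 0≤f (suc k)) i))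

module SignSequences (m : ℕ) where

  open ℤCyclic m
  open ℤ∑ using (sum-syntax; sum-cong-≗; ∑-distrib-+)
  open import Algebra.Properties.Semiring.Sum ℤ.+-*-semiring using (*-distribˡ-sum)
  open Data.Integer.Solver.+-*-Solver using (solve; _:=_; _:+_; _:*_; _:-_; con)

  -- With u = σ - 1 ∈ {0, -2}: σσ′ = uu′ + u + u′ + 1, where 4 ∣ uu′ and the two sums of u
  -- agree by periodicity and are even.
  autocorrelation-mod-4 : ∀ σ → Periodic σ → (∀ k → IsSign (σ k)) → ∀ s →
    + 4 ℤ.∣ autocorrelation σ s ℤ.- + n
  autocorrelation-mod-4 σ per signs s =
    subst (+ 4 ℤ.∣_) (sym R-n≡P+[U+U]) (ℤ.∣m∣n⇒∣m+n (∣-∑ P 4∣P) 4∣U+U)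
    where
    open ≡-Reasoning
    u : ℕ → ℤ
    u k = σ k ℤ.- 1ℤ
    P : Fin n → ℤ
    P k = u (toℕ k) ℤ.* u (toℕ k ℕ.+ s)
    U : ℤ
    U = ∑[ k < n ] u (toℕ k)
    4∣P : ∀ k → + 4 ℤ.∣ P k
    4∣P k with isSign⇒2∣x-1 (signs (toℕ k)) | isSign⇒2∣x-1 (signs (toℕ k ℕ.+ s))
    ... | divides a eqa | divides b eqb = divides (a ℤ.* b) (trans (cong₂ ℤ._*_ eqa eqb)
      (solve 2 (λ a b → (a :* con (+ 2)) :* (b :* con (+ 2)) := a :* b :* con (+ 4)) refl a b))
    4∣U+U : + 4 ℤ.∣ U ℤ.+ U
    4∣U+U with ∣-∑ {n = n} (λ k → u (toℕ k)) (λ k → isSign⇒2∣x-1 (signs (toℕ k)))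
    ... | divides q eq = divides q (trans (cong₂ ℤ._+_ eq eq)
      (solve 1 (λ q → q :* con (+ 2) :+ q :* con (+ 2) := q :* con (+ 4)) refl q))
    split : ∀ x y → x ℤ.* y ≡ (x ℤ.- 1ℤ) ℤ.* (y ℤ.- 1ℤ) ℤ.+ ((x ℤ.- 1ℤ) ℤ.+ ((y ℤ.- 1ℤ) ℤ.+ 1ℤ))
    split = solve 2 (λ x y → x :* y
                          := (x :- con 1ℤ) :* (y :- con 1ℤ) :+ ((x :- con 1ℤ) :+ ((y :- con 1ℤ) :+ con 1ℤ))) refl
    R≡P+[U+[U+n]] : autocorrelation σ s ≡ ℤ∑.sum P ℤ.+ (U ℤ.+ (U ℤ.+ + n))
    R≡P+[U+[U+n]] = begin
      autocorrelation σ s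
        ≡⟨ sum-cong-≗ {n} (λ k → split (σ (toℕ k)) (σ (toℕ k ℕ.+ s))) ⟩
      ∑[ k < n ] (P k ℤ.+ (u (toℕ k) ℤ.+ (u (toℕ k ℕ.+ s) ℤ.+ 1ℤ)))
        ≡⟨ ∑-distrib-+ {n} P (λ k → u (toℕ k) ℤ.+ (u (toℕ k ℕ.+ s) ℤ.+ 1ℤ)) ⟩
      ℤ∑.sum P ℤ.+ ∑[ k < n ] (u (toℕ k) ℤ.+ (u (toℕ k ℕ.+ s) ℤ.+ 1ℤ))
        ≡⟨ cong (λ x → ℤ∑.sum P ℤ.+ x)
             (trans (∑-distrib-+ {n} (λ k → u (toℕ k)) (λ k → u (toℕ k ℕ.+ s) ℤ.+ 1ℤ))
                    (cong (λ x → U ℤ.+ x) (∑-distrib-+ {n} (λ k → u (toℕ k ℕ.+ s)) (λ _ → 1ℤ)))) ⟩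
      ℤ∑.sum P ℤ.+ (U ℤ.+ (∑[ k < n ] u (toℕ k ℕ.+ s) ℤ.+ ∑[ k < n ] 1ℤ))
        ≡⟨ cong (λ x → ℤ∑.sum P ℤ.+ (U ℤ.+ x))
                (cong₂ ℤ._+_ (∑-shift u (λ k → cong (ℤ._- 1ℤ) (per k)) s) (∑-ones n)) ⟩
      ℤ∑.sum P ℤ.+ (U ℤ.+ (U ℤ.+ + n)) ∎
    R-n≡P+[U+U] : autocorrelation σ s ℤ.- + n ≡ ℤ∑.sum P ℤ.+ (U ℤ.+ U)
    R-n≡P+[U+U] = trans (cong (ℤ._- + n) R≡P+[U+[U+n]])
      (solve 3 (λ p u n → p :+ (u :+ (u :+ n)) :- n := p :+ (u :+ u)) refl (ℤ∑.sum P) U (+ n))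

  first+term≤∑ : ∀ (x : ℕ → ℤ) → (∀ k → 0ℤ ℤ.≤ x k) → ∀ {j} → 0 < j → j < n →
    x 0 ℤ.+ x j ℤ.≤ ∑[ k < n ] x (toℕ k)
  first+term≤∑ x 0≤x {suc j} _ (s≤s j<m) = ℤ.+-monoʳ-≤ (x 0)
    (subst (ℤ._≤ ∑[ k < m ] x (suc (toℕ k))) (cong (λ i → x (suc i)) (Fin.toℕ-fromℕ< j<m))
      (term≤∑ (λ k → x (suc (toℕ k))) (λ k → 0≤x (suc (toℕ k))) (fromℕ< j<m)))

  -- The terms of n + εR(s) = Σₖ (1 + ε σₖ σₖ₊ₛ) are ≥ 0, and those at k = 0 and k = n - s are 2.
  autocorrelation-lower-bound : ∀ σ → Periodic σ → (∀ k → IsSign (σ k)) → σ 0 ≡ 1ℤ →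
    ∀ {s} → 0 < s → s < n → σ (n ∸ s) ≡ σ s → + 4 ℤ.≤ + n ℤ.+ σ s ℤ.* autocorrelation σ s
  autocorrelation-lower-bound σ per signs σ₀≡1 {s} 0<s s<n σ[n∸s]≡σs = begin
    + 4
      ≡⟨ cong₂ ℤ._+_ t₀≡2 t[n∸s]≡2 ⟨
    t 0 ℤ.+ t (n ∸ s)
      ≤⟨ first+term≤∑ t 0≤t (ℕ.m<n⇒0<n∸m s<n) (ℕ.∸-monoʳ-< 0<s (ℕ.<⇒≤ s<n)) ⟩
    ∑[ k < n ] t (toℕ k)
      ≡⟨ ∑-distrib-+ {n} (λ _ → 1ℤ) (λ k → ε ℤ.* (σ (toℕ k) ℤ.* σ (toℕ k ℕ.+ s))) ⟩
    ∑[ k < n ] 1ℤ ℤ.+ ∑[ k < n ] (ε ℤ.* (σ (toℕ k) ℤ.* σ (toℕ k ℕ.+ s)))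
      ≡⟨ cong₂ ℤ._+_ (∑-ones n) (sym (*-distribˡ-sum {n} ε (λ k → σ (toℕ k) ℤ.* σ (toℕ k ℕ.+ s)))) ⟩
    + n ℤ.+ ε ℤ.* autocorrelation σ s ∎
    where
    open ℤ.≤-Reasoning
    ε = σ s
    t : ℕ → ℤ
    t k = 1ℤ ℤ.+ ε ℤ.* (σ k ℤ.* σ (k ℕ.+ s))
    0≤t : ∀ k → 0ℤ ℤ.≤ t k
    0≤t k = isSign⇒0≤1+x (isSign-* (signs s) (isSign-* (signs k) (signs (k ℕ.+ s))))
    1+ε[x]≡2 : ∀ {x} → x ≡ ε → 1ℤ ℤ.+ ε ℤ.* x ≡ + 2
    1+ε[x]≡2 refl = cong (λ y → 1ℤ ℤ.+ y) (isSign-square (signs s))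
    t₀≡2 : t 0 ≡ + 2
    t₀≡2 = 1+ε[x]≡2 (trans (cong (ℤ._* ε) σ₀≡1) (ℤ.*-identityˡ ε))
    σn≡1 : σ (n ∸ s ℕ.+ s) ≡ 1ℤ
    σn≡1 = trans (cong σ (trans (ℕ.m∸n+n≡m (ℕ.<⇒≤ s<n)) (sym (ℕ.+-identityʳ n)))) (trans (per 0) σ₀≡1)
    t[n∸s]≡2 : t (n ∸ s) ≡ + 2
    t[n∸s]≡2 = 1+ε[x]≡2 (trans (cong₂ ℤ._*_ σ[n∸s]≡σs σn≡1) (ℤ.*-identityʳ ε))

-- Parities and congruences mod 4

module _ where

  open Data.Integer.Solver.+-*-Solver using (solve; _:=_; _:+_; _:*_; _:-_; :-_; con)

  2∤1 : ¬ (+ 2 ℤ.∣ 1ℤ)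
  2∤1 2∣1 with ℕ.∣1⇒≡1 (ℤ.∣⇒∣ᵤ 2∣1)
  ... | ()

  2∣4 : + 2 ℤ.∣ + 4
  2∣4 = divides (+ 2) refl

  2∣2[m-1] : ∀ m → + 2 ℤ.∣ + 2 ℤ.* (m ℤ.- 1ℤ)
  2∣2[m-1] m = divides (m ℤ.- 1ℤ) (ℤ.*-comm (+ 2) (m ℤ.- 1ℤ))

  4∣2x⇒2∣x : ∀ {x} → + 4 ℤ.∣ + 2 ℤ.* x → + 2 ℤ.∣ x
  4∣2x⇒2∣x {x} (divides q 2x≡q*4) = divides q (ℤ.*-cancelˡ-≡ (+ 2) x (q ℤ.* + 2)
    (trans 2x≡q*4 (solve 1 (λ q → q :* con (+ 4) := con (+ 2) :* (q :* con (+ 2))) refl q)))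

  4∣-n⇒2∣n : ∀ n → + 4 ℤ.∣ 0ℤ ℤ.- + n → 2 ℕ.∣ n
  4∣-n⇒2∣n n 4∣-n = ℕ.∣-trans (ℕ.divides 2 refl)
    (subst (4 ℕ.∣_) (trans (cong ℤ.∣_∣ (ℤ.+-identityˡ (ℤ.- + n))) (ℤ.∣-i∣≡∣i∣ (+ n))) (ℤ.∣⇒∣ᵤ 4∣-n))

  2∣εn⇒2∣n : ∀ {ε n} → IsSign ε → + 2 ℤ.∣ ε ℤ.* + n → 2 ℕ.∣ n
  2∣εn⇒2∣n {ε} {n} ε± 2∣εn = ℤ.∣⇒∣ᵤ (subst (+ 2 ℤ.∣_) ε[εn]≡n (ℤ.∣n⇒∣m*n ε 2∣εn))
    where
    ε[εn]≡n : ε ℤ.* (ε ℤ.* + n) ≡ + n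
    ε[εn]≡n = trans (sym (ℤ.*-assoc ε ε (+ n)))
                    (trans (cong (ℤ._* + n) (isSign-square ε±)) (ℤ.*-identityˡ (+ n)))

  2∣n⊎2∣1+n : ∀ n → 2 ℕ.∣ n ⊎ 2 ℕ.∣ suc n
  2∣n⊎2∣1+n ℕ.zero  = inj₁ (ℕ.divides 0 refl)
  2∣n⊎2∣1+n (suc n) with 2∣n⊎2∣1+n n
  ... | inj₁ 2∣n   = inj₂ (ℕ.∣m∣n⇒∣m+n (ℕ.∣-refl {2}) 2∣n)
  ... | inj₂ 2∣1+n = inj₁ 2∣1+n

  odd-sum-parity : ∀ m h → + 2 ℤ.∣ m ℤ.+ + h ℤ.+ 1ℤ → (2 ℕ.∤ ℤ.∣ m ∣) ⇔ (2 ℕ.∣ h)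
  odd-sum-parity m h 2∣m+h+1 = mk⇔ odd⇒even even⇒odd
    where
    even⇒odd : 2 ℕ.∣ h → 2 ℕ.∤ ℤ.∣ m ∣
    even⇒odd 2∣h 2∣m =
      2∤1 (ℤ.∣m+n∣m⇒∣n 2∣m+h+1 (ℤ.∣m∣n⇒∣m+n (ℤ.∣ᵤ⇒∣ {+ 2} {m} 2∣m) (ℤ.∣ᵤ⇒∣ {+ 2} {+ h} 2∣h)))
    odd⇒even : 2 ℕ.∤ ℤ.∣ m ∣ → 2 ℕ.∣ h
    odd⇒even m-odd with 2∣n⊎2∣1+n h
    ... | inj₁ 2∣h   = 2∣h
    ... | inj₂ 2∣1+h =
      ⊥-elim (m-odd (ℤ.∣⇒∣ᵤ (ℤ.∣m+n∣n⇒∣m {m = m} 2∣m+[1+h] (ℤ.∣ᵤ⇒∣ {+ 2} {+ suc h} 2∣1+h))))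
      where
      2∣m+[1+h] : + 2 ℤ.∣ m ℤ.+ + suc h
      2∣m+[1+h] = subst (+ 2 ℤ.∣_)
        (trans (ℤ.+-assoc m (+ h) 1ℤ) (cong (λ k → m ℤ.+ k) (ℤ.+-comm (+ h) 1ℤ))) 2∣m+h+1

  even-κ-parity : ∀ {ε κ} m n → IsSign ε → κ ≡ + 2 ℤ.* m → + 4 ℤ.∣ κ ℤ.+ ε ℤ.* + n ℤ.- + 2 →
    (2 ℕ.∣ n) × ((2 ℕ.∤ ℤ.∣ m ∣) ⇔ (2 ℕ.∣ n / 2))
  even-κ-parity {ε} m n ε± refl 4∣X = 2∣n , odd-sum-parity m h 2∣m+h+1
    where
    2∣n : 2 ℕ.∣ n
    2∣n = 2∣εn⇒2∣n ε± (ℤ.∣m+n∣m⇒∣n (subst (+ 2 ℤ.∣_) X≡ (ℤ.∣-trans 2∣4 4∣X)) (2∣2[m-1] m))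
      where
      X≡ : + 2 ℤ.* m ℤ.+ ε ℤ.* + n ℤ.- + 2 ≡ + 2 ℤ.* (m ℤ.- 1ℤ) ℤ.+ ε ℤ.* + n
      X≡ = solve 3 (λ m ε n → con (+ 2) :* m :+ ε :* n :- con (+ 2)
                           := con (+ 2) :* (m :- con 1ℤ) :+ ε :* n) refl m ε (+ n)
    h : ℕ
    h = n / 2
    n≡2h : + n ≡ + 2 ℤ.* + h
    n≡2h = trans (cong +_ (sym (m/n*n≡m 2∣n))) (trans (ℤ.pos-* h 2) (ℤ.*-comm (+ h) (+ 2)))
    2∣m+εh-1 : + 2 ℤ.∣ m ℤ.+ ε ℤ.* + h ℤ.- 1ℤ
    2∣m+εh-1 = 4∣2x⇒2∣x (subst (+ 4 ℤ.∣_) X≡ 4∣X)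
      where
      X≡ : + 2 ℤ.* m ℤ.+ ε ℤ.* + n ℤ.- + 2 ≡ + 2 ℤ.* (m ℤ.+ ε ℤ.* + h ℤ.- 1ℤ)
      X≡ = trans (cong (λ k → + 2 ℤ.* m ℤ.+ ε ℤ.* k ℤ.- + 2) n≡2h)
        (solve 3 (λ m ε h → con (+ 2) :* m :+ ε :* (con (+ 2) :* h) :- con (+ 2)
                          := con (+ 2) :* (m :+ ε :* h :- con 1ℤ)) refl m ε (+ h))
    2∣m+h+1 : + 2 ℤ.∣ m ℤ.+ + h ℤ.+ 1ℤ
    2∣m+h+1 = subst (+ 2 ℤ.∣_) Y≡
      (ℤ.∣m∣n⇒∣m+n (ℤ.∣m∣n⇒∣m-n 2∣m+εh-1 (ℤ.∣m⇒∣m*n (+ h) (isSign⇒2∣x-1 ε±))) (divides 1ℤ refl))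
      where
      Y≡ : m ℤ.+ ε ℤ.* + h ℤ.- 1ℤ ℤ.- (ε ℤ.- 1ℤ) ℤ.* + h ℤ.+ + 2 ≡ m ℤ.+ + h ℤ.+ 1ℤ
      Y≡ = solve 3 (λ m ε h → m :+ ε :* h :- con 1ℤ :- (ε :- con 1ℤ) :* h :+ con (+ 2)
                           := m :+ h :+ con 1ℤ) refl m ε (+ h)

  odd-κ⇒odd-n : ∀ {ε κ} m n → IsSign ε → κ ≡ + 2 ℤ.* m ℤ.+ 1ℤ → + 4 ℤ.∣ κ ℤ.+ ε ℤ.* + n ℤ.- + 2 →
    2 ℕ.∤ n
  odd-κ⇒odd-n {ε} m n ε± refl 4∣X 2∣n = 2∤1 (ℤ.∣m+n∣m⇒∣n (subst (+ 2 ℤ.∣_) X≡ (ℤ.∣-trans 2∣4 4∣X))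
    (ℤ.∣m∣n⇒∣m+n (2∣2[m-1] m) (ℤ.∣n⇒∣m*n ε (ℤ.∣ᵤ⇒∣ {+ 2} {+ n} 2∣n))))
    where
    X≡ : + 2 ℤ.* m ℤ.+ 1ℤ ℤ.+ ε ℤ.* + n ℤ.- + 2 ≡ (+ 2 ℤ.* (m ℤ.- 1ℤ) ℤ.+ ε ℤ.* + n) ℤ.+ 1ℤ
    X≡ = solve 3 (λ m ε n → (con (+ 2) :* m :+ con 1ℤ) :+ ε :* n :- con (+ 2)
                         := (con (+ 2) :* (m :- con 1ℤ) :+ ε :* n) :+ con 1ℤ) refl m ε (+ n)

  opposite-signs⇒2∣n : ∀ κ n → + 4 ℤ.∣ κ ℤ.+ 1ℤ ℤ.* + n ℤ.- + 2 → + 4 ℤ.∣ κ ℤ.+ -1ℤ ℤ.* + n ℤ.- + 2 →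
    2 ℕ.∣ n
  opposite-signs⇒2∣n κ n 4∣X₊ 4∣X₋ =
    ℤ.∣⇒∣ᵤ (4∣2x⇒2∣x (subst (+ 4 ℤ.∣_) X₊-X₋≡2n (ℤ.∣m∣n⇒∣m-n 4∣X₊ 4∣X₋)))
    where
    X₊-X₋≡2n : κ ℤ.+ 1ℤ ℤ.* + n ℤ.- + 2 ℤ.- (κ ℤ.+ -1ℤ ℤ.* + n ℤ.- + 2) ≡ + 2 ℤ.* + n
    X₊-X₋≡2n = solve 2 (λ κ n → κ :+ con 1ℤ :* n :- con (+ 2) :- (κ :+ con -1ℤ :* n :- con (+ 2))
                              := con (+ 2) :* n) refl κ (+ n)

  signs-agree-if-odd : ∀ {ε ε′ κ κ′} n → 2 ℕ.∤ n → IsSign ε → IsSign ε′ → κ ≡ κ′ →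
    + 4 ℤ.∣ κ ℤ.+ ε ℤ.* + n ℤ.- + 2 → + 4 ℤ.∣ κ′ ℤ.+ ε′ ℤ.* + n ℤ.- + 2 → ε ≡ ε′
  signs-agree-if-odd n n-odd (inj₁ refl) (inj₁ refl) refl _    _    = refl
  signs-agree-if-odd n n-odd (inj₂ refl) (inj₂ refl) refl _    _    = refl
  signs-agree-if-odd {κ = κ} n n-odd (inj₁ refl) (inj₂ refl) refl 4∣X₊ 4∣X₋ =
    ⊥-elim (n-odd (opposite-signs⇒2∣n κ n 4∣X₊ 4∣X₋))
  signs-agree-if-odd {κ = κ} n n-odd (inj₂ refl) (inj₁ refl) refl 4∣X₋ 4∣X₊ =
    ⊥-elim (n-odd (opposite-signs⇒2∣n κ n 4∣X₊ 4∣X₋))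

  lower-bound⇒κ+2≤n : ∀ n ε R → + 4 ℤ.≤ n ℤ.+ ε ℤ.* R → (+ 2 ℤ.- ε ℤ.* R) ℤ.+ + 2 ℤ.≤ n
  lower-bound⇒κ+2≤n n ε R 4≤n+εR = subst₂ ℤ._≤_
    (solve 2 (λ ε R → con (+ 4) :- ε :* R := (con (+ 2) :- ε :* R) :+ con (+ 2)) refl ε R)
    (solve 3 (λ n ε R → n :+ ε :* R :- ε :* R := n) refl n ε R)
    (ℤ.+-monoˡ-≤ (ℤ.- (ε ℤ.* R)) 4≤n+εR)

  R≡n-mod-4⇒κ≡2-εn-mod-4 : ∀ n ε R → + 4 ℤ.∣ R ℤ.- n → + 4 ℤ.∣ (+ 2 ℤ.- ε ℤ.* R) ℤ.+ ε ℤ.* n ℤ.- + 2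
  R≡n-mod-4⇒κ≡2-εn-mod-4 n ε R 4∣R-n = subst (+ 4 ℤ.∣_)
    (solve 3 (λ n ε R → (:- ε) :* (R :- n) := (con (+ 2) :- ε :* R) :+ ε :* n :- con (+ 2)) refl n ε R)
    (ℤ.∣n⇒∣m*n (ℤ.- ε) 4∣R-n)

-- Circulant matrices

Σ≡∑ : ∀ {n} (f : Fin n → ℚ) → Σ n f ≡ ℚ∑.sum f
Σ≡∑ {ℕ.zero} f = refl
Σ≡∑ {suc n}  f = cong (f zero ℚ.+_) (Σ≡∑ (λ k → f (suc k)))

scalarI-off-diagonal : ∀ {n} λ′ {i j : Fin n} → i ≢ j → scalarI λ′ i j ≡ 0ℚ
scalarI-off-diagonal λ′ {i} {j} i≢j with i Fin.≟ j
... | yes i≡j = ⊥-elim (i≢j i≡j)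
... | no _    = refl

module CirculantGram {m : ℕ} (c : Fin (suc m) → ℚ) where

  open ℚCyclic m

  gram-row-zero : ∀ t →
    (circulant c · transpose (circulant c)) zero t ≡ autocorrelation (cyclic c) (n ∸ toℕ t)
  gram-row-zero t = trans (Σ≡∑ (λ k → circulant c zero k ℚ.* circulant c t k)) (ℚ∑.sum-cong-≗ {n} λ k →
    cong₂ ℚ._*_ (cyclic-periodic c (toℕ k)) (cong (cyclic c) (n+k∸t≡k+[n∸t] (toℕ k))))
    where
    n+k∸t≡k+[n∸t] : ∀ k → n ℕ.+ k ∸ toℕ t ≡ k ℕ.+ (n ∸ toℕ t)
    n+k∸t≡k+[n∸t] k = trans (cong (_∸ toℕ t) (ℕ.+-comm n k)) (ℕ.+-∸-assoc k (ℕ.<⇒≤ (Fin.toℕ<n t)))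

  scalar-gram⇒perfect : ∀ {λ′} → (∀ i j → (circulant c · transpose (circulant c)) i j ≡ scalarI λ′ i j) →
    Perfect (cyclic c)
  scalar-gram⇒perfect {λ′} gram≡λI {s} 0<s s<n = begin
    autocorrelation (cyclic c) s                   ≡⟨ cong (autocorrelation (cyclic c)) n∸t≡s ⟨
    autocorrelation (cyclic c) (n ∸ toℕ t)         ≡⟨ gram-row-zero t ⟨
    (circulant c · transpose (circulant c)) zero t ≡⟨ gram≡λI zero t ⟩
    scalarI λ′ zero t                              ≡⟨ scalarI-off-diagonal λ′ zero≢t ⟩
    0ℚ                                             ∎
    where
    open ≡-Reasoning
    t : Fin n
    t = fromℕ< (ℕ.∸-monoʳ-< 0<s (ℕ.<⇒≤ s<n))
    toℕt≡n∸s : toℕ t ≡ n ∸ s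
    toℕt≡n∸s = Fin.toℕ-fromℕ< _
    n∸t≡s : n ∸ toℕ t ≡ s
    n∸t≡s = trans (cong (n ∸_) toℕt≡n∸s) (ℕ.m∸[m∸n]≡n (ℕ.<⇒≤ s<n))
    zero≢t : zero ≢ t
    zero≢t zero≡t = ℕ.<⇒≢ (ℕ.m<n⇒0<n∸m s<n) (trans (cong toℕ zero≡t) toℕt≡n∸s)

-- Perfect sequences (d, ±1, …, ±1)

module PerfectSequence (m : ℕ) (1<n : 1 < suc m) (d : ℚ) (0≤d : 0ℚ ℚ.≤ d) (c : Fin (suc m) → ℚ)
  (c₀≡d : c zero ≡ d) (c≡±1 : ∀ j → c (suc j) ≡ 1ℚ ⊎ c (suc j) ≡ ℚ.- 1ℚ)
  (perfect : ℚCyclic.Perfect m (ℚCyclic.cyclic m c))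
  where

  open ℤCyclic m using (n; cyclic; cyclic-periodic; cyclic-toℕ; autocorrelation)
  open SignSequences m
  open Data.Rational.Solver.+-*-Solver using (solve; _:=_; _:+_; _:*_; _:-_; con)

  -- The signs of c, with the entry d at index 0 replaced by s₀.
  signs : ℤ → Fin n → ℤ
  signs s₀ zero    = s₀
  signs s₀ (suc j) = sign (c (suc j))

  σ : ℤ → ℕ → ℤ
  σ s₀ = cyclic (signs s₀)

  σ-isSign : ∀ {s₀} → IsSign s₀ → ∀ k → IsSign (σ s₀ k)
  σ-isSign s₀± k with k mod n
  ... | zero  = s₀±
  ... | suc j = sign-isSign (c (suc j))

  c≡signs+impulse : ∀ s₀ j → c j ≡ ι (signs s₀ j) ℚ.+ (d ℚ.- ι s₀) ℚ.* ℚCyclic.impulse m j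
  c≡signs+impulse s₀ zero    = trans c₀≡d (solve 2 (λ d x → d := x :+ (d :- x) :* con 1ℚ) refl d (ι s₀))
  c≡signs+impulse s₀ (suc j) = trans (sym (ι-sign (c≡±1 j)))
    (solve 2 (λ x a → x := x :+ a :* con 0ℚ) refl (ι (sign (c (suc j)))) (d ℚ.- ι s₀))

  signs-autocorrelation : ∀ s₀ {s} → 0 < s → s < n →
    ι (autocorrelation (σ s₀) s) ℚ.+ (d ℚ.- ι s₀) ℚ.* (ι (σ s₀ s) ℚ.+ ι (σ s₀ (n ∸ s))) ≡ 0ℚ
  signs-autocorrelation s₀ {s} 0<s s<n = begin
    ι (autocorrelation (σ s₀) s) ℚ.+ a ℚ.* b
      ≡⟨ cong (ℚ._+ a ℚ.* b) (ι-autocorrelation m (σ s₀) s) ⟩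
    ℚCyclic.autocorrelation m (ℚCyclic.cyclic m (λ j → ι (signs s₀ j))) s ℚ.+ a ℚ.* b
      ≡⟨ ℚCyclic.autocorrelation-perturb m c (λ j → ι (signs s₀ j)) a (c≡signs+impulse s₀) 0<s s<n ⟨
    ℚCyclic.autocorrelation m (ℚCyclic.cyclic m c) s
      ≡⟨ perfect 0<s s<n ⟩
    0ℚ ∎
    where
    open ≡-Reasoning
    a = d ℚ.- ι s₀
    b = ι (σ s₀ s) ℚ.+ ι (σ s₀ (n ∸ s))

  σ₁ : ℕ → ℤ
  σ₁ = σ 1ℤ

  σ₁-isSign : ∀ k → IsSign (σ₁ k)
  σ₁-isSign = σ-isSign (inj₁ refl)

  asymmetric⇒2∣n : ∀ {s} → 0 < s → s < n → σ₁ (n ∸ s) ≢ σ₁ s → 2 ℕ.∣ n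
  asymmetric⇒2∣n {s} 0<s s<n asym = 4∣-n⇒2∣n n
    (subst (λ r → + 4 ℤ.∣ r ℤ.- + n) R≡0
      (autocorrelation-mod-4 σ₁ (cyclic-periodic (signs 1ℤ)) σ₁-isSign s))
    where
    R = autocorrelation σ₁ s
    ισs+ισ[n∸s]≡0 : ι (σ₁ s) ℚ.+ ι (σ₁ (n ∸ s)) ≡ 0ℚ
    ισs+ισ[n∸s]≡0 = trans (sym (ι-+ (σ₁ s) (σ₁ (n ∸ s))))
      (cong ι (isSign-opposite (σ₁-isSign s) (σ₁-isSign (n ∸ s)) (λ eq → asym (sym eq))))
    R≡0 : R ≡ 0ℤ
    R≡0 = ι-injective (begin
      ι R
        ≡⟨ solve 2 (λ r a → r := r :+ a :* con 0ℚ) refl (ι R) (d ℚ.- 1ℚ) ⟩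
      ι R ℚ.+ (d ℚ.- 1ℚ) ℚ.* 0ℚ
        ≡⟨ cong (λ v → ι R ℚ.+ (d ℚ.- 1ℚ) ℚ.* v) ισs+ισ[n∸s]≡0 ⟨
      ι R ℚ.+ (d ℚ.- 1ℚ) ℚ.* (ι (σ₁ s) ℚ.+ ι (σ₁ (n ∸ s)))
        ≡⟨ signs-autocorrelation 1ℤ 0<s s<n ⟩
      0ℚ ∎)
      where open ≡-Reasoning

  record SymmetricShift : Set where
    field
      s         : ℕ
      0<s       : 0 < s
      s<n       : s < n
      symmetric : σ₁ (n ∸ s) ≡ σ₁ s

    ε : ℤ
    ε = σ₁ s

    κ : ℤ
    κ = + 2 ℤ.- ε ℤ.* autocorrelation σ₁ s

  module _ (S : SymmetricShift) where

    open SymmetricShift S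

    2d≡κ : ι (+ 2) ℚ.* d ≡ ι κ
    2d≡κ = begin
      ι (+ 2) ℚ.* d
        ≡⟨ solve 3 (λ x e d → con (ι (+ 2)) :* d
                     := con (ι (+ 2)) :- e :* x :+ e :* (x :+ (d :- con 1ℚ) :* (e :+ e))
                        :+ (d :- con 1ℚ) :* (con (ι (+ 2)) :- (e :* e :+ e :* e))) refl (ι R) (ι ε) d ⟩
      ι (+ 2) ℚ.- ι ε ℚ.* ι R ℚ.+ ι ε ℚ.* (ι R ℚ.+ (d ℚ.- 1ℚ) ℚ.* (ι ε ℚ.+ ι ε))
        ℚ.+ (d ℚ.- 1ℚ) ℚ.* (ι (+ 2) ℚ.- (ι ε ℚ.* ι ε ℚ.+ ι ε ℚ.* ι ε))
        ≡⟨ cong₂ (λ u v → ι (+ 2) ℚ.- ι ε ℚ.* ι R ℚ.+ ι ε ℚ.* u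
                          ℚ.+ (d ℚ.- 1ℚ) ℚ.* (ι (+ 2) ℚ.- (v ℚ.+ v))) symmetric-equation ιε²≡1 ⟩
      ι (+ 2) ℚ.- ι ε ℚ.* ι R ℚ.+ ι ε ℚ.* 0ℚ ℚ.+ (d ℚ.- 1ℚ) ℚ.* (ι (+ 2) ℚ.- (1ℚ ℚ.+ 1ℚ))
        ≡⟨ solve 3 (λ x e d → con (ι (+ 2)) :- e :* x :+ e :* con 0ℚ
                                :+ (d :- con 1ℚ) :* (con (ι (+ 2)) :- (con 1ℚ :+ con 1ℚ))
                     := con (ι (+ 2)) :- e :* x) refl (ι R) (ι ε) d ⟩
      ι (+ 2) ℚ.- ι ε ℚ.* ι R
        ≡⟨ cong (ι (+ 2) ℚ.+_) (trans (ι-neg (ε ℤ.* R)) (cong ℚ.-_ (ι-* ε R))) ⟨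
      ι (+ 2) ℚ.+ ι (ℤ.- (ε ℤ.* R))
        ≡⟨ ι-+ (+ 2) (ℤ.- (ε ℤ.* R)) ⟨
      ι κ ∎
      where
      open ≡-Reasoning
      R = autocorrelation σ₁ s
      symmetric-equation : ι R ℚ.+ (d ℚ.- 1ℚ) ℚ.* (ι ε ℚ.+ ι ε) ≡ 0ℚ
      symmetric-equation = subst (λ y → ι R ℚ.+ (d ℚ.- 1ℚ) ℚ.* (ι ε ℚ.+ ι y) ≡ 0ℚ) symmetric
        (signs-autocorrelation 1ℤ 0<s s<n)
      ιε²≡1 : ι ε ℚ.* ι ε ≡ 1ℚ
      ιε²≡1 = trans (sym (ι-* ε ε)) (cong ι (isSign-square (σ₁-isSign s)))

    κ+2≤n : κ ℤ.+ + 2 ℤ.≤ + n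
    κ+2≤n = lower-bound⇒κ+2≤n (+ n) ε (autocorrelation σ₁ s)
      (autocorrelation-lower-bound σ₁ (cyclic-periodic (signs 1ℤ)) σ₁-isSign refl 0<s s<n symmetric)

    κ≡2-εn-mod-4 : + 4 ℤ.∣ κ ℤ.+ ε ℤ.* + n ℤ.- + 2
    κ≡2-εn-mod-4 = R≡n-mod-4⇒κ≡2-εn-mod-4 (+ n) ε (autocorrelation σ₁ s)
      (autocorrelation-mod-4 σ₁ (cyclic-periodic (signs 1ℤ)) σ₁-isSign s)

    2[d+1]≤n : ι (+ 2) ℚ.* (d ℚ.+ 1ℚ) ℚ.≤ ι (+ n)
    2[d+1]≤n = ℚ.≤-trans (ℚ.≤-reflexive 2[d+1]≡κ+2) (ι-mono-≤ κ+2≤n)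
      where
      2[d+1]≡κ+2 : ι (+ 2) ℚ.* (d ℚ.+ 1ℚ) ≡ ι (κ ℤ.+ + 2)
      2[d+1]≡κ+2 = trans (ℚ.*-distribˡ-+ (ι (+ 2)) d 1ℚ)
        (trans (cong₂ ℚ._+_ 2d≡κ (ℚ.*-identityʳ (ι (+ 2)))) (sym (ι-+ κ (+ 2))))

    integral⇒κ≡2k : ∀ k → d ≡ ι k → κ ≡ + 2 ℤ.* k
    integral⇒κ≡2k k d≡k =
      ι-injective (trans (sym 2d≡κ) (trans (cong (ι (+ 2) ℚ.*_) d≡k) (sym (ι-* (+ 2) k))))

    half-integral⇒κ≡2k+1 : ∀ k → d ℚ.- ℚ.½ ≡ ι k → κ ≡ + 2 ℤ.* k ℤ.+ 1ℤ
    half-integral⇒κ≡2k+1 k d-½≡k = ι-injective (begin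
      ι κ                                  ≡⟨ 2d≡κ ⟨
      ι (+ 2) ℚ.* d                        ≡⟨ solve 1 (λ d → con (ι (+ 2)) :* d
                                                := con (ι (+ 2)) :* (d :- con ℚ.½) :+ con 1ℚ) refl d ⟩
      ι (+ 2) ℚ.* (d ℚ.- ℚ.½) ℚ.+ 1ℚ       ≡⟨ cong (λ x → ι (+ 2) ℚ.* x ℚ.+ 1ℚ) d-½≡k ⟩
      ι (+ 2) ℚ.* ι k ℚ.+ 1ℚ               ≡⟨ cong (ℚ._+ 1ℚ) (ι-* (+ 2) k) ⟨
      ι (+ 2 ℤ.* k) ℚ.+ ι 1ℤ               ≡⟨ ι-+ (+ 2 ℤ.* k) 1ℤ ⟨
      ι (+ 2 ℤ.* k ℤ.+ 1ℤ)                 ∎)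
      where open ≡-Reasoning

  halfway-shift : 2 ℕ.∣ n → SymmetricShift
  halfway-shift (ℕ.divides (suc h) n≡[1+h]*2) = record
    { s         = suc h
    ; 0<s       = s≤s z≤n
    ; s<n       = subst (suc h <_) (sym n≡h+h) (ℕ.m<m+n (suc h) (s≤s z≤n))
    ; symmetric = cong σ₁ (trans (cong (_∸ suc h) n≡h+h) (ℕ.m+n∸m≡n (suc h) (suc h)))
    }
    where
    n≡h+h : n ≡ suc h ℕ.+ suc h
    n≡h+h = trans n≡[1+h]*2 (trans (ℕ.*-comm (suc h) 2) (cong (suc h ℕ.+_) (ℕ.+-identityʳ (suc h))))

  symmetric-shift : SymmetricShift
  symmetric-shift with σ₁ (n ∸ 1) ℤ.≟ σ₁ 1
  ... | yes symmetric₁  = record { s = 1 ; 0<s = s≤s z≤n ; s<n = 1<n ; symmetric = symmetric₁ }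
  ... | no  asymmetric₁ = halfway-shift (asymmetric⇒2∣n (s≤s z≤n) 1<n asymmetric₁)

  odd⇒symmetric-shift : 2 ℕ.∤ n → ∀ {s} → 0 < s → s < n → SymmetricShift
  odd⇒symmetric-shift n-odd {s} 0<s s<n = record
    { s         = s
    ; 0<s       = 0<s
    ; s<n       = s<n
    ; symmetric = decidable-stable (σ₁ (n ∸ s) ℤ.≟ σ₁ s) (λ asym → n-odd (asymmetric⇒2∣n 0<s s<n asym))
    }

  odd⇒σ₁-constant : 2 ℕ.∤ n → ∀ {s} → 0 < s → s < n → σ₁ s ≡ σ₁ 1
  odd⇒σ₁-constant n-odd {s} 0<s s<n =
    signs-agree-if-odd n n-odd (σ₁-isSign s) (σ₁-isSign 1) κ≡κ₁ (κ≡2-εn-mod-4 S) (κ≡2-εn-mod-4 S₁)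
    where
    S  = odd⇒symmetric-shift n-odd 0<s s<n
    S₁ = odd⇒symmetric-shift n-odd (s≤s z≤n) 1<n
    κ≡κ₁ : SymmetricShift.κ S ≡ SymmetricShift.κ S₁
    κ≡κ₁ = ι-injective (trans (sym (2d≡κ S)) (2d≡κ S₁))

  -- With s₀ = ε the sign sequence is constant, so its autocorrelation at 1 is n.
  odd⇒n≡2[d+1] : 2 ℕ.∤ n → ι (+ n) ≡ ι (+ 2) ℚ.* (d ℚ.+ 1ℚ)
  odd⇒n≡2[d+1] n-odd = solve-for-n (σ₁-isSign 1) constant-equation
    where
    ε = σ₁ 1
    σε≡ε : ∀ k → σ ε k ≡ ε
    σε≡ε k with k mod n
    ... | zero  = refl
    ... | suc j = trans (sym (cyclic-toℕ (signs 1ℤ) (suc j)))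
                        (odd⇒σ₁-constant n-odd (s≤s z≤n) (Fin.toℕ<n (suc j)))
    R≡n : autocorrelation (σ ε) 1 ≡ + n
    R≡n = trans (ℤ∑.sum-cong-≗ {n} (λ k → trans (cong₂ ℤ._*_ (σε≡ε (toℕ k)) (σε≡ε (toℕ k ℕ.+ 1)))
                                                 (isSign-square (σ₁-isSign 1))))
                (∑-ones n)
    constant-equation : ι (+ n) ℚ.+ (d ℚ.- ι ε) ℚ.* (ι ε ℚ.+ ι ε) ≡ 0ℚ
    constant-equation = begin
      ι (+ n) ℚ.+ (d ℚ.- ι ε) ℚ.* (ι ε ℚ.+ ι ε)
        ≡⟨ cong₂ (λ r v → ι r ℚ.+ (d ℚ.- ι ε) ℚ.* v) R≡n
                 (cong₂ (λ u w → ι u ℚ.+ ι w) (σε≡ε 1) (σε≡ε (n ∸ 1))) ⟨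
      ι (autocorrelation (σ ε) 1) ℚ.+ (d ℚ.- ι ε) ℚ.* (ι (σ ε 1) ℚ.+ ι (σ ε (n ∸ 1)))
        ≡⟨ signs-autocorrelation ε (s≤s z≤n) 1<n ⟩
      0ℚ ∎
      where open ≡-Reasoning
    solve-for-n : ∀ {ε} → IsSign ε → ι (+ n) ℚ.+ (d ℚ.- ι ε) ℚ.* (ι ε ℚ.+ ι ε) ≡ 0ℚ →
      ι (+ n) ≡ ι (+ 2) ℚ.* (d ℚ.+ 1ℚ)
    solve-for-n (inj₂ refl) equation₋ = begin
      ι (+ n)
        ≡⟨ solve 2 (λ x d → x := x :+ (d :- con (ℚ.- 1ℚ)) :* (con (ℚ.- 1ℚ) :+ con (ℚ.- 1ℚ))
                                  :+ con (ι (+ 2)) :* (d :+ con 1ℚ)) refl (ι (+ n)) d ⟩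
      ι (+ n) ℚ.+ (d ℚ.- ℚ.- 1ℚ) ℚ.* (ℚ.- 1ℚ ℚ.+ ℚ.- 1ℚ) ℚ.+ ι (+ 2) ℚ.* (d ℚ.+ 1ℚ)
        ≡⟨ cong (ℚ._+ ι (+ 2) ℚ.* (d ℚ.+ 1ℚ)) equation₋ ⟩
      0ℚ ℚ.+ ι (+ 2) ℚ.* (d ℚ.+ 1ℚ)
        ≡⟨ ℚ.+-identityˡ _ ⟩
      ι (+ 2) ℚ.* (d ℚ.+ 1ℚ) ∎
      where open ≡-Reasoning
    solve-for-n (inj₁ refl) equation₊ = ⊥-elim (n-odd (subst (2 ℕ.∣_) (sym n≡2) (ℕ.divides 1 refl)))
      where
      n+2d≡2 : ι (+ n) ℚ.+ (d ℚ.+ d) ≡ ι (+ 2)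
      n+2d≡2 = begin
        ι (+ n) ℚ.+ (d ℚ.+ d)
          ≡⟨ solve 2 (λ x d → x :+ (d :+ d) := x :+ (d :- con 1ℚ) :* (con 1ℚ :+ con 1ℚ) :+ con (ι (+ 2)))
                   refl (ι (+ n)) d ⟩
        ι (+ n) ℚ.+ (d ℚ.- 1ℚ) ℚ.* (1ℚ ℚ.+ 1ℚ) ℚ.+ ι (+ 2)
          ≡⟨ cong (ℚ._+ ι (+ 2)) equation₊ ⟩
        0ℚ ℚ.+ ι (+ 2)
          ≡⟨ ℚ.+-identityˡ _ ⟩
        ι (+ 2) ∎
        where open ≡-Reasoning
      n≤n+2d : ι (+ n) ℚ.≤ ι (+ n) ℚ.+ (d ℚ.+ d)
      n≤n+2d = ℚ.≤-trans (ℚ.≤-reflexive (sym (ℚ.+-identityʳ (ι (+ n)))))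
                         (ℚ.+-monoʳ-≤ (ι (+ n)) (ℚ.+-mono-≤ 0≤d 0≤d))
      n≤2 : n ℕ.≤ 2
      n≤2 = ℤ.drop‿+≤+ (ι-cancel-≤ (ℚ.≤-trans n≤n+2d (ℚ.≤-reflexive n+2d≡2)))
      n≡2 : n ≡ 2
      n≡2 = ℕ.≤-antisym n≤2 1<n

open import Data.Nat as ℕ using (ℕ; _∸_; _≤_)
open import Data.Nat.DivMod using (_/_)
open import Data.Nat.Divisibility using (_∣_; _∤_)
open import Data.Integer as ℤ using (ℤ; ∣_∣)
open import Data.Fin using (Fin; toℕ)
open import Data.Rational as ℚ using (ℚ; 0ℚ; 1ℚ; ½; _+_; _*_; _-_; -_)
open import Data.Product using (∃; _×_)
open import Data.Sum using (_⊎_)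
open import Function.Bundles using (_⇔_)
open import Relation.Binary.PropositionalEquality using (_≡_; _≢_)

proposition3p1 : (n : ℕ) → 2 ≤ n → (d : ℚ) → 0ℚ ℚ.≤ d → (c : Fin n → ℚ)
    → (∀ j → toℕ j ≡ 0 → c j ≡ d)
    → (∀ j → toℕ j ≢ 0 → c j ≡ 1ℚ ⊎ c j ≡ - 1ℚ)
    → (∀ i j → (circulant c · transpose (circulant c)) i j ≡ scalarI (d * d + (ℤ.+ (n ∸ 1) ℚ./ 1)) i j)
    → (∃ λ (k : ℤ) → (ℤ.+ 2 ℚ./ 1) * d ≡ k ℚ./ 1)
      × ((ℤ.+ 2 ℚ./ 1) * (d + 1ℚ) ℚ.≤ (ℤ.+ n ℚ./ 1))
      × (∀ (m : ℤ) → d ≡ m ℚ./ 1 → (2 ∣ n) × ((2 ∤ ∣ m ∣) ⇔ (2 ∣ n / 2)))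
      × (∀ (m : ℤ) → d - ½ ≡ m ℚ./ 1 → (2 ∤ n) × ((ℤ.+ n ℚ./ 1) ≡ (ℤ.+ 2 ℚ./ 1) * (d + 1ℚ)))
proposition3p1 (suc m) 2≤n d 0≤d c c₀≡d c≡±1 gram≡λI =
  (κ , 2d≡κ S) , 2[d+1]≤n S , integral , half-integral
  where
  open PerfectSequence m 2≤n d 0≤d c (c₀≡d zero refl) (λ j → c≡±1 (suc j) λ ())
    (CirculantGram.scalar-gram⇒perfect c gram≡λI)
  S = symmetric-shift
  open SymmetricShift S using (s; κ)

  integral : ∀ k → d ≡ ι k → (2 ∣ suc m) × ((2 ∤ ∣ k ∣) ⇔ (2 ∣ suc m / 2))
  integral k d≡k = even-κ-parity k (suc m) (σ₁-isSign s) (integral⇒κ≡2k S k d≡k) (κ≡2-εn-mod-4 S)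

  half-integral : ∀ k → d - ½ ≡ ι k → (2 ∤ suc m) × (ι (+ suc m) ≡ ι (+ 2) * (d + 1ℚ))
  half-integral k d-½≡k = n-odd , odd⇒n≡2[d+1] n-odd
    where
    n-odd = odd-κ⇒odd-n k (suc m) (σ₁-isSign s) (half-integral⇒κ≡2k+1 S k d-½≡k) (κ≡2-εn-mod-4 S)
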